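{- Let $G_1,\dots,G_n$ be connected graphs with roots $R_{G_1},\dots,R_{G_n}$, and let $d_{R_{G_i}}=d(R_{G_i},Res(G_i,R_{G_i}))$. Let $\mathcal{G}_{\max}=\{G_j : d_{R_{G_j}}=\max_{1\le i\le n} d_{R_{G_i}}\}$ and suppose the graphs are indexed so that $\mathcal{G}_{\max}=\{G_1,\dots,G_k\}$, $1\le k\le n$. Then $Res(G_1\boxtimes\cdots\boxtimes G_n,\;R_{G_1}\boxtimes\cdots\boxtimes R_{G_n})$ is isomorphic to the subgraph of $G_1\boxtimes\cdots\boxtimes G_n$ induced on \[\bigcup_{1\le i\le k} V(G_1)\times\cdots\times V(G_{i-1})\times V(Res(G_i,R_{G_i}))\times V(G_{i+1})\times\cdots\times V(G_n).\] If $k=1$, this graph equals $Res(G_1,R_{G_1})\boxtimes G_2\boxtimes\cdots\boxtimes G_n$.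
   Context: A root of a connected finite graph $G$ is an induced subgraph $R_G=\langle V_0\rangle$ on a nonempty vertex set $V_0$; with $V_i$ the set of vertices at distance exactly $i$ from $V_0$ and $r$ the largest $i$ with $V_i\ne\emptyset$, the distance-residual graph is $Res(G,R_G)=\langle V_r\rangle$, and $d(R_G,Res(G,R_G))=r$. $\boxtimes$ is the strong product: vertex set the Cartesian product of vertex sets, two distinct vertices adjacent iff in every coordinate they are equal or adjacent. The product of roots is the induced subgraph on the product of their vertex sets. -}

module Defs where

open import Level using (0ℓ)
open import Data.Nat using (ℕ; zero; suc; _≤_; _<_; _⊔_)
open import Data.Fin using (Fin; zero; suc; toℕ)
open import Data.Product using (Σ; ∃; _×_; _,_; proj₁; proj₂)
open import Data.Sum using (_⊎_; inj₁; inj₂)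
open import Data.List using (List; foldr; tabulate)
open import Relation.Nullary using (¬_; Dec)
open import Relation.Binary using (Setoid; IsEquivalence)
open import Relation.Binary.PropositionalEquality as ≡ using (_≡_)
open import Function.Bundles using (Inverse; _⇔_)

record Graph : Set₁ where
  field
    V        : Set
    _≈_      : V → V → Set
    isEquiv  : IsEquivalence _≈_
    E        : V → V → Set
    E-resp   : ∀ {x x' y y'} → x ≈ x' → y ≈ y' → E x y → E x' y'
    E-sym    : ∀ {x y} → E x y → E y x
    E-irrefl : ∀ {x y} → x ≈ y → ¬ E x y

  setoid : Setoid 0ℓ 0ℓ
  setoid = record { Carrier = V ; _≈_ = _≈_ ; isEquivalence = isEquiv }

open Graph public

IsFinite : Graph → Set
IsFinite G = (Σ ℕ λ m → Inverse (setoid G) (≡.setoid (Fin m)))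
           × (∀ x y → Dec (E G x y))

data Walk (G : Graph) : V G → V G → ℕ → Set where
  nil  : ∀ {u v} → _≈_ G u v → Walk G u v 0
  cons : ∀ {u w v ℓ} → E G u w → Walk G w v ℓ → Walk G u v (suc ℓ)

Connected : Graph → Set
Connected G = ∀ u v → ∃ λ ℓ → Walk G u v ℓ

-- A root of G, given by its (nonempty, decidable, ≈-closed) vertex set V₀;
-- the root itself is the induced subgraph on V₀.
record IsRoot (G : Graph) (V₀ : V G → Set) : Set where
  field
    resp     : ∀ {x y} → _≈_ G x y → V₀ x → V₀ y
    dec      : ∀ x → Dec (V₀ x)
    nonempty : ∃ λ x → V₀ x

ReachIn : (G : Graph) → (V G → Set) → V G → ℕ → Set
ReachIn G V₀ v ℓ = ∃ λ u → V₀ u × Walk G u v ℓ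

AtDist : (G : Graph) → (V G → Set) → V G → ℕ → Set
AtDist G V₀ v i = ReachIn G V₀ v i × (∀ j → j < i → ¬ ReachIn G V₀ v j)

-- r is the largest i with V_i ≠ ∅, i.e. r = d(R_G, Res(G, R_G))
IsResDist : (G : Graph) → (V G → Set) → ℕ → Set
IsResDist G V₀ r = (∃ λ v → AtDist G V₀ v r) × (∀ v i → AtDist G V₀ v i → i ≤ r)

InRes : (G : Graph) → (V G → Set) → V G → Set
InRes G V₀ v = ∃ λ r → IsResDist G V₀ r × AtDist G V₀ v r

Induced : (G : Graph) → (V G → Set) → Graph
Induced G P = record
  { V        = Σ (V G) P
  ; _≈_      = λ x y → _≈_ G (proj₁ x) (proj₁ y)
  ; isEquiv  = record
      { refl  = IsEquivalence.refl (isEquiv G)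
      ; sym   = IsEquivalence.sym (isEquiv G)
      ; trans = IsEquivalence.trans (isEquiv G) }
  ; E        = λ x y → E G (proj₁ x) (proj₁ y)
  ; E-resp   = E-resp G
  ; E-sym    = E-sym G
  ; E-irrefl = E-irrefl G
  }

Res : (G : Graph) → (V G → Set) → Graph
Res G V₀ = Induced G (InRes G V₀)

⊠ : ∀ {n} → (Fin n → Graph) → Graph
⊠ {n} G = record
  { V        = (i : Fin n) → V (G i)
  ; _≈_      = Eq
  ; isEquiv  = record
      { refl  = λ i → IsEquivalence.refl (isEquiv (G i))
      ; sym   = λ p i → IsEquivalence.sym (isEquiv (G i)) (p i)
      ; trans = λ p q i → IsEquivalence.trans (isEquiv (G i)) (p i) (q i) }
  ; E        = Adj
  ; E-resp   = resp
  ; E-sym    = symm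
  ; E-irrefl = λ p a → proj₁ a p
  }
  where
  Eq : ((i : Fin n) → V (G i)) → ((i : Fin n) → V (G i)) → Set
  Eq x y = ∀ i → _≈_ (G i) (x i) (y i)
  Adj : ((i : Fin n) → V (G i)) → ((i : Fin n) → V (G i)) → Set
  Adj x y = ¬ Eq x y × (∀ i → _≈_ (G i) (x i) (y i) ⊎ E (G i) (x i) (y i))
  trans' : ∀ i {a b c} → _≈_ (G i) a b → _≈_ (G i) b c → _≈_ (G i) a c
  trans' i = IsEquivalence.trans (isEquiv (G i))
  sym' : ∀ i {a b} → _≈_ (G i) a b → _≈_ (G i) b a
  sym' i = IsEquivalence.sym (isEquiv (G i))
  resp : ∀ {x x' y y'} → Eq x x' → Eq y y' → Adj x y → Adj x' y'
  resp {x} {x'} {y} {y'} p q (ne , a) =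
      (λ e → ne (λ i → trans' i (p i) (trans' i (e i) (sym' i (q i)))))
    , λ i → step i (a i)
    where
    step : ∀ i → _≈_ (G i) (x i) (y i) ⊎ E (G i) (x i) (y i)
               → _≈_ (G i) (x' i) (y' i) ⊎ E (G i) (x' i) (y' i)
    step i (inj₁ e) = inj₁ (trans' i (sym' i (p i)) (trans' i e (q i)))
    step i (inj₂ e) = inj₂ (E-resp (G i) (p i) (q i) e)
  symm : ∀ {x y} → Adj x y → Adj y x
  symm (ne , a) = (λ e → ne (λ i → sym' i (e i))) , λ i → sw i (a i)
    where
    sw : ∀ i {u v} → _≈_ (G i) u v ⊎ E (G i) u v → _≈_ (G i) v u ⊎ E (G i) v u
    sw i (inj₁ e) = inj₁ (sym' i e)
    sw i (inj₂ e) = inj₂ (E-sym (G i) e)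

ProdRoot : ∀ {n} (G : Fin n → Graph) → ((i : Fin n) → V (G i) → Set) → V (⊠ G) → Set
ProdRoot G R x = ∀ i → R i (x i)

record _≅_ (G H : Graph) : Set where
  field
    iso : Inverse (setoid G) (setoid H)
    adj : ∀ x y → E G x y ⇔ E H (Inverse.to iso x) (Inverse.to iso y)

-- maximum of d 0, …, d (n-1) (0 if n = 0)
maxD : ∀ {n} → (Fin n → ℕ) → ℕ
maxD d = foldr _⊔_ 0 (tabulate d)

UnionRes : ∀ {n} (G : Fin n → Graph) → ((i : Fin n) → V (G i) → Set) → ℕ → V (⊠ G) → Set
UnionRes G R k x = ∃ λ i → toℕ i < k × InRes (G i) (R i) (x i)

resFirst : ∀ {n} (G : Fin n → Graph) → ((i : Fin n) → V (G i) → Set) → Fin n → Graph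
resFirst G R zero    = Res (G zero) (R zero)
resFirst G R (suc i) = G (suc i)

{-# OPTIONS --safe #-}
module Submission where

open import Defs
open import Data.Nat using (ℕ; zero; suc; _≤_; _<_; z≤n; s≤s)
open import Data.Nat.Properties
  using (≤-refl; ≤-trans; ≤-antisym; ≮⇒≥; <⇒≱; m≤n⇒m≤1+n; m≤m⊔n; m≤n⊔m; ⊔-lub; ⊔-sel; ⊔-identityʳ; anyUpTo?)
open import Data.Nat.Induction using (<-rec)
open import Data.Fin using (Fin; zero; suc; toℕ)
import Data.Fin.Properties as Fin
open import Data.Product using (∃; _×_; _,_; proj₁; proj₂)
open import Data.Sum using (_⊎_; inj₁; inj₂)
open import Function using (_∘_; id)
open import Relation.Nullary using (¬_; Dec; yes; no)
open import Relation.Nullary.Decidable using (map′; _×-dec_; via-injection)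
open import Relation.Binary using (IsEquivalence)
open import Relation.Binary.PropositionalEquality as ≡ using (_≡_; refl)
open import Function.Bundles using (Inverse; _⇔_; mk⇔; Equivalence)
open import Function.Properties.Inverse using (Inverse⇒Injection)

-- In a strong product a step is a step-or-stay in every coordinate, so the
-- product root reaches x within L steps iff every Rᵢ reaches xᵢ within L
-- steps; the distance of x is therefore the maximum of the coordinate
-- distances. Consequently the eccentricity of the product root is D = max dᵢ,
-- and x is at distance D iff some xᵢ is at distance D from Rᵢ, which forces
-- dᵢ = D and xᵢ ∈ Res(Gᵢ, Rᵢ). Finiteness is only needed to find distances
-- constructively, as least lengths of walks from the root.

E⁼ : (G : Graph) → V G → V G → Set
E⁼ G u w = _≈_ G u w ⊎ E G u w

data LazyWalk (G : Graph) : V G → V G → ℕ → Set where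
  nil  : ∀ {u v} → _≈_ G u v → LazyWalk G u v 0
  cons : ∀ {u w v ℓ} → E⁼ G u w → LazyWalk G w v ℓ → LazyWalk G u v (suc ℓ)

ReachWithin : (G : Graph) → (V G → Set) → V G → ℕ → Set
ReachWithin G V₀ v L = ∃ λ m → m ≤ L × ReachIn G V₀ v m

HasDistances : (G : Graph) → (V G → Set) → Set
HasDistances G V₀ = ∀ v → ∃ (AtDist G V₀ v)

module _ {G : Graph} where
  open IsEquivalence (isEquiv G) renaming (refl to ≈-refl; sym to ≈-sym; trans to ≈-trans)

  walk-≈ˡ : ∀ {u u' v m} → _≈_ G u' u → Walk G u v m → Walk G u' v m
  walk-≈ˡ e (nil e')   = nil (≈-trans e e')
  walk-≈ˡ e (cons a w) = cons (E-resp G (≈-sym e) ≈-refl a) w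

  lazyWalk-stay : ∀ {u v} L → _≈_ G u v → LazyWalk G u v L
  lazyWalk-stay zero    e = nil e
  lazyWalk-stay (suc L) e = cons (inj₁ e) (lazyWalk-stay L ≈-refl)

  walk⇒lazyWalk : ∀ {u v m L} → m ≤ L → Walk G u v m → LazyWalk G u v L
  walk⇒lazyWalk {L = L} _         (nil e)    = lazyWalk-stay L e
  walk⇒lazyWalk         (s≤s m≤L) (cons a w) = cons (inj₂ a) (walk⇒lazyWalk m≤L w)

  lazyWalk⇒walk : ∀ {u v L} → LazyWalk G u v L → ∃ λ m → m ≤ L × Walk G u v m
  lazyWalk⇒walk (nil e) = 0 , z≤n , nil e
  lazyWalk⇒walk (cons (inj₁ e) w) =
    let m , m≤L , w' = lazyWalk⇒walk w in m , m≤n⇒m≤1+n m≤L , walk-≈ˡ e w'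
  lazyWalk⇒walk (cons (inj₂ a) w) =
    let m , m≤L , w' = lazyWalk⇒walk w in suc m , s≤s m≤L , cons a w'

  lazyWalk-nil⁻¹ : ∀ {u v} → LazyWalk G u v 0 → _≈_ G u v
  lazyWalk-nil⁻¹ (nil e) = e

  lazyWalk-uncons : ∀ {u v L} → LazyWalk G u v (suc L) → ∃ λ w → E⁼ G u w × LazyWalk G w v L
  lazyWalk-uncons (cons s w) = _ , s , w

  module _ {V₀ : V G → Set} where

    reachWithin⇒lazyWalk : ∀ {v L} → ReachWithin G V₀ v L → ∃ λ u → V₀ u × LazyWalk G u v L
    reachWithin⇒lazyWalk (_ , m≤L , u , u∈V₀ , w) = u , u∈V₀ , walk⇒lazyWalk m≤L w

    lazyWalk⇒reachWithin : ∀ {u v L} → V₀ u → LazyWalk G u v L → ReachWithin G V₀ v L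
    lazyWalk⇒reachWithin u∈V₀ w = let m , m≤L , w' = lazyWalk⇒walk w in m , m≤L , _ , u∈V₀ , w'

    AtDist-least : ∀ {v δ L} → AtDist G V₀ v δ → ReachWithin G V₀ v L → δ ≤ L
    AtDist-least (_ , minimal) (m , m≤L , r) = ≤-trans (≮⇒≥ λ m<δ → minimal m m<δ r) m≤L

    AtDist-intro : ∀ {v L} → ReachWithin G V₀ v L → (∀ j → ReachIn G V₀ v j → L ≤ j) → AtDist G V₀ v L
    AtDist-intro {v} (m , m≤L , r) lower =
      ≡.subst (ReachIn G V₀ v) (≤-antisym m≤L (lower m r)) r , λ j j<L r' → <⇒≱ j<L (lower j r')

    AtDist-unique : ∀ {v δ δ'} → AtDist G V₀ v δ → AtDist G V₀ v δ' → δ ≡ δ'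
    AtDist-unique at at' =
      ≤-antisym (AtDist-least at (_ , ≤-refl , proj₁ at')) (AtDist-least at' (_ , ≤-refl , proj₁ at))

    IsResDist-unique : ∀ {r r'} → IsResDist G V₀ r → IsResDist G V₀ r' → r ≡ r'
    IsResDist-unique ((v , at) , bound) ((v' , at') , bound') = ≤-antisym (bound' v _ at) (bound v' _ at')

    InRes⇔AtDist : ∀ {r v} → IsResDist G V₀ r → InRes G V₀ v ⇔ AtDist G V₀ v r
    InRes⇔AtDist {v = v} isr = mk⇔
      (λ (r' , isr' , at) → ≡.subst (AtDist G V₀ v) (IsResDist-unique isr' isr) at)
      (λ at → _ , isr , at)

  module _ (fin : IsFinite G) where
    open Inverse (proj₂ (proj₁ fin)) using (to; from; strictlyInverseʳ)

    ∃? : {P : V G → Set} → (∀ {x y} → _≈_ G x y → P x → P y) → (∀ x → Dec (P x)) → Dec (∃ P)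
    ∃? resp P? = map′ (λ (j , p) → from j , p) (λ (x , p) → to x , resp (≈-sym (strictlyInverseʳ x)) p)
                      (Fin.any? (P? ∘ from))

    _≈?_ : ∀ u v → Dec (_≈_ G u v)
    _≈?_ = via-injection (Inverse⇒Injection (proj₂ (proj₁ fin))) Fin._≟_

    walk? : ∀ u v m → Dec (Walk G u v m)
    walk? u v zero    = map′ nil (λ { (nil e) → e }) (u ≈? v)
    walk? u v (suc m) =
      map′ (λ (_ , a , w) → cons a w) (λ { (cons a w) → _ , a , w })
           (∃? (λ e (a , w) → E-resp G ≈-refl e a , walk-≈ˡ (≈-sym e) w)
               (λ w → proj₂ fin u w ×-dec walk? w v m))

    reachIn? : {V₀ : V G → Set} → IsRoot G V₀ → ∀ v m → Dec (ReachIn G V₀ v m)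
    reachIn? root v m =
      ∃? (λ e (u∈V₀ , w) → IsRoot.resp root e u∈V₀ , walk-≈ˡ (≈-sym e) w)
         (λ u → IsRoot.dec root u ×-dec walk? u v m)

Least : (ℕ → Set) → ℕ → Set
Least P δ = P δ × (∀ j → j < δ → ¬ P j)

least-witness : {P : ℕ → Set} → (∀ n → Dec (P n)) → ∀ {m} → P m → ∃ (Least P)
least-witness {P} P? = <-rec (λ m → P m → ∃ (Least P)) search _
  where
  search : ∀ m → (∀ {j} → j < m → P j → ∃ (Least P)) → P m → ∃ (Least P)
  search m below p with anyUpTo? P? m
  ... | yes (j , j<m , pj) = below j<m pj
  ... | no none            = m , p , λ j j<m pj → none (j , j<m , pj)

finite-connected⇒hasDistances : ∀ {G V₀} → IsFinite G → Connected G → IsRoot G V₀ → HasDistances G V₀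
finite-connected⇒hasDistances fin con root v =
  let u , u∈V₀ = IsRoot.nonempty root
      ℓ , w    = con u v
  in least-witness (reachIn? fin root v) (u , u∈V₀ , w)

maxD-upper : ∀ {n} (d : Fin n → ℕ) i → d i ≤ maxD d
maxD-upper d zero    = m≤m⊔n (d zero) _
maxD-upper d (suc i) = ≤-trans (maxD-upper (d ∘ suc) i) (m≤n⊔m (d zero) _)

maxD-least : ∀ {n} (d : Fin n → ℕ) {m} → (∀ i → d i ≤ m) → maxD d ≤ m
maxD-least {zero}  _ _ = z≤n
maxD-least {suc n} d h = ⊔-lub (h zero) (maxD-least (d ∘ suc) (h ∘ suc))

maxD-mono : ∀ {n} {d e : Fin n → ℕ} → (∀ i → d i ≤ e i) → maxD d ≤ maxD e
maxD-mono {d = d} {e} d≤e = maxD-least d λ i → ≤-trans (d≤e i) (maxD-upper e i)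

maxD-attained : ∀ {n} (d : Fin (suc n) → ℕ) → ∃ λ i → d i ≡ maxD d
maxD-attained {zero}  d = zero , ≡.sym (⊔-identityʳ (d zero))
maxD-attained {suc n} d with ⊔-sel (d zero) (maxD (d ∘ suc))
... | inj₁ eq = zero , ≡.sym eq
... | inj₂ eq = let i , eqᵢ = maxD-attained (d ∘ suc) in suc i , ≡.trans eqᵢ (≡.sym eq)

∀⊎⇒∀⊎∃ : ∀ {n} {A B : Fin n → Set} → (∀ i → A i ⊎ B i) → (∀ i → A i) ⊎ ∃ B
∀⊎⇒∀⊎∃ {zero}  f = inj₁ λ ()
∀⊎⇒∀⊎∃ {suc n} f with f zero | ∀⊎⇒∀⊎∃ (f ∘ suc)
... | inj₂ b | _            = inj₂ (zero , b)
... | inj₁ _ | inj₂ (i , b) = inj₂ (suc i , b)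
... | inj₁ a | inj₁ as      = inj₁ λ { zero → a ; (suc i) → as i }

Induced-cong : ∀ (G : Graph) {P Q : V G → Set} → (∀ x → P x ⇔ Q x) → Induced G P ≅ Induced G Q
Induced-cong G P⇔Q = record
  { iso = record
      { to = λ (x , p) → x , Equivalence.to (P⇔Q x) p
      ; from = λ (x , q) → x , Equivalence.from (P⇔Q x) q
      ; to-cong = λ e → e ; from-cong = λ e → e ; inverse = (λ e → e) , (λ e → e) }
  ; adj = λ _ _ → mk⇔ (λ a → a) (λ a → a) }

module _ {n} {G : Fin n → Graph} where

  ⊠-E⁼⇒ : ∀ {x y} → E⁼ (⊠ G) x y → ∀ i → E⁼ (G i) (x i) (y i)
  ⊠-E⁼⇒ (inj₁ x≈y)    i = inj₁ (x≈y i)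
  ⊠-E⁼⇒ (inj₂ (_ , s)) i = s i

  ⊠-E⁼⇐ : ∀ {x y} → (∀ i → E⁼ (G i) (x i) (y i)) → E⁼ (⊠ G) x y
  ⊠-E⁼⇐ s with ∀⊎⇒∀⊎∃ s
  ... | inj₁ x≈y     = inj₁ x≈y
  ... | inj₂ (i , a) = inj₂ ((λ x≈y → E-irrefl (G i) (x≈y i) a) , s)

  ⊠-lazyWalk⇒ : ∀ {x y L} → LazyWalk (⊠ G) x y L → ∀ i → LazyWalk (G i) (x i) (y i) L
  ⊠-lazyWalk⇒ (nil x≈y)  i = nil (x≈y i)
  ⊠-lazyWalk⇒ (cons s w) i = cons (⊠-E⁼⇒ s i) (⊠-lazyWalk⇒ w i)

  ⊠-lazyWalk⇐ : ∀ {x y} L → (∀ i → LazyWalk (G i) (x i) (y i) L) → LazyWalk (⊠ G) x y L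
  ⊠-lazyWalk⇐ zero    ws = nil (lazyWalk-nil⁻¹ ∘ ws)
  ⊠-lazyWalk⇐ (suc L) ws = cons (⊠-E⁼⇐ (proj₁ ∘ proj₂ ∘ steps)) (⊠-lazyWalk⇐ L (proj₂ ∘ proj₂ ∘ steps))
    where steps = λ i → lazyWalk-uncons (ws i)

  module _ {R : (i : Fin n) → V (G i) → Set} where

    ⊠-reachWithin⇒ : ∀ {x L} → ReachWithin (⊠ G) (ProdRoot G R) x L → ∀ i → ReachWithin (G i) (R i) (x i) L
    ⊠-reachWithin⇒ r i = let u , u∈R , w = reachWithin⇒lazyWalk r in
      lazyWalk⇒reachWithin (u∈R i) (⊠-lazyWalk⇒ w i)

    ⊠-reachWithin⇐ : ∀ {x L} → (∀ i → ReachWithin (G i) (R i) (x i) L) → ReachWithin (⊠ G) (ProdRoot G R) x L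
    ⊠-reachWithin⇐ {L = L} rs =
      lazyWalk⇒reachWithin (proj₁ ∘ proj₂ ∘ walks) (⊠-lazyWalk⇐ L (proj₂ ∘ proj₂ ∘ walks))
      where walks = λ i → reachWithin⇒lazyWalk (rs i)

    ⊠-AtDist : ∀ {x δ} → (∀ i → AtDist (G i) (R i) (x i) (δ i)) → AtDist (⊠ G) (ProdRoot G R) x (maxD δ)
    ⊠-AtDist {δ = δ} at = AtDist-intro
      (⊠-reachWithin⇐ λ i → δ i , maxD-upper δ i , proj₁ (at i))
      (λ j r → maxD-least δ λ i → AtDist-least (at i) (⊠-reachWithin⇒ (j , ≤-refl , r) i))

⊠-IsResDist : ∀ {n} {G : Fin n → Graph} {R : (i : Fin n) → V (G i) → Set} {d : Fin n → ℕ}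
  → (∀ i → HasDistances (G i) (R i)) → (∀ i → IsResDist (G i) (R i) (d i))
  → IsResDist (⊠ G) (ProdRoot G R) (maxD d)
⊠-IsResDist {d = d} dist hd = (_ , ⊠-AtDist (proj₂ ∘ proj₁ ∘ hd)) , bound
  where
  bound : ∀ x j → AtDist _ _ x j → j ≤ maxD d
  bound x j at = ≡.subst (_≤ maxD d) (AtDist-unique (⊠-AtDist (λ i → proj₂ (dist i (x i)))) at)
                         (maxD-mono λ i → proj₂ (hd i) (x i) _ (proj₂ (dist i (x i))))

⊠-InRes⇔ : ∀ {n} {G : Fin (suc n) → Graph} {R : (i : Fin (suc n)) → V (G i) → Set} {d : Fin (suc n) → ℕ}
  → (∀ i → HasDistances (G i) (R i)) → (∀ i → IsResDist (G i) (R i) (d i))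
  → ∀ x → InRes (⊠ G) (ProdRoot G R) x ⇔ (∃ λ i → d i ≡ maxD d × InRes (G i) (R i) (x i))
⊠-InRes⇔ {G = G} {R} {d} dist hd x = mk⇔ project embed
  where
  D = maxD d
  δ : Fin _ → ℕ
  δ i = proj₁ (dist i (x i))
  at-δ : ∀ i → AtDist (G i) (R i) (x i) (δ i)
  at-δ i = proj₂ (dist i (x i))
  δ≤d : ∀ i → δ i ≤ d i
  δ≤d i = proj₂ (hd i) (x i) _ (at-δ i)
  InRes⇔AtDist-D : InRes (⊠ G) (ProdRoot G R) x ⇔ AtDist (⊠ G) (ProdRoot G R) x D
  InRes⇔AtDist-D = InRes⇔AtDist (⊠-IsResDist dist hd)

  project : InRes (⊠ G) (ProdRoot G R) x → ∃ λ i → d i ≡ D × InRes (G i) (R i) (x i)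
  project inRes = i , dᵢ≡D , Equivalence.from (InRes⇔AtDist (hd i)) (≡.subst (AtDist (G i) (R i) (x i)) δᵢ≡dᵢ (at-δ i))
    where
    i = proj₁ (maxD-attained δ)
    δᵢ≡D : δ i ≡ D
    δᵢ≡D = ≡.trans (proj₂ (maxD-attained δ)) (AtDist-unique (⊠-AtDist at-δ) (Equivalence.to InRes⇔AtDist-D inRes))
    dᵢ≡D : d i ≡ D
    dᵢ≡D = ≤-antisym (maxD-upper d i) (≡.subst (_≤ d i) δᵢ≡D (δ≤d i))
    δᵢ≡dᵢ : δ i ≡ d i
    δᵢ≡dᵢ = ≡.trans δᵢ≡D (≡.sym dᵢ≡D)

  embed : (∃ λ i → d i ≡ D × InRes (G i) (R i) (x i)) → InRes (⊠ G) (ProdRoot G R) x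
  embed (i , dᵢ≡D , inResᵢ) =
    Equivalence.from InRes⇔AtDist-D (≡.subst (AtDist (⊠ G) (ProdRoot G R) x) maxδ≡D (⊠-AtDist at-δ))
    where
    δᵢ≡D : δ i ≡ D
    δᵢ≡D = AtDist-unique (at-δ i) (≡.subst (AtDist (G i) (R i) (x i)) dᵢ≡D (Equivalence.to (InRes⇔AtDist (hd i)) inResᵢ))
    maxδ≡D : maxD δ ≡ D
    maxδ≡D = ≤-antisym (maxD-mono δ≤d) (≡.subst (_≤ maxD δ) δᵢ≡D (maxD-upper δ i))

module _ {n} {G : Fin (suc n) → Graph} {R : (i : Fin (suc n)) → V (G i) → Set} where

  private
    U = Induced (⊠ G) (UnionRes G R 1)
    F = ⊠ (resFirst G R)

    -- resFirst G R computes only on constructors, so U and F have the same coordinate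
    -- relations index by index but not uniformly in the index.
    by-cases : {A B : Fin (suc n) → Set} → (A zero → B zero) → (∀ {j} → A (suc j) → B (suc j))
             → (∀ i → A i) → ∀ i → B i
    by-cases f g h zero    = f (h zero)
    by-cases f g h (suc j) = g (h (suc j))

  UnionRes-1⇒InRes₀ : ∀ {x} → UnionRes G R 1 x → InRes (G zero) (R zero) (x zero)
  UnionRes-1⇒InRes₀ (zero  , _       , inRes) = inRes
  UnionRes-1⇒InRes₀ (suc _ , s≤s () , _)

  restrict : V U → V F
  restrict (x , u) zero    = x zero , UnionRes-1⇒InRes₀ u
  restrict (x , u) (suc j) = x (suc j)

  extend : V F → V U
  extend y = (λ { zero → proj₁ (y zero) ; (suc j) → y (suc j) }) , zero , s≤s z≤n , proj₂ (y zero)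

  ⊠-resFirst-≅ : U ≅ F
  ⊠-resFirst-≅ = record
    { iso = record
        { to = restrict ; from = extend
        ; to-cong = by-cases id id ; from-cong = by-cases id id
        ; inverse = by-cases id id , by-cases id id }
    ; adj = λ _ _ → mk⇔ (λ (x≉y , s) → x≉y ∘ by-cases id id , by-cases id id s)
                        (λ (x≉y , s) → x≉y ∘ by-cases id id , by-cases id id s) }

corollary2 : (n : ℕ) (G : Fin n → Graph)
    → (∀ i → IsFinite (G i)) → (∀ i → Connected (G i))
    → (R : (i : Fin n) → V (G i) → Set) → (∀ i → IsRoot (G i) (R i))
    → (d : Fin n → ℕ) → (∀ i → IsResDist (G i) (R i) (d i))
    → (k : ℕ) → 1 ≤ k → k ≤ n
    → (∀ j → (toℕ j < k) ⇔ (d j ≡ maxD d))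
    → (Res (⊠ G) (ProdRoot G R) ≅ Induced (⊠ G) (UnionRes G R k))
      × (k ≡ 1 → Induced (⊠ G) (UnionRes G R k) ≅ ⊠ (resFirst G R))
corollary2 zero    _ _   _   _ _    _ _  _ (s≤s z≤n) () _
corollary2 (suc n) G fin con R root d hd k _ _ isMax =
  Induced-cong (⊠ G) InRes⇔UnionRes , λ { refl → ⊠-resFirst-≅ }
  where
  dist : ∀ i → HasDistances (G i) (R i)
  dist i = finite-connected⇒hasDistances (fin i) (con i) (root i)

  InRes⇔UnionRes : ∀ x → InRes (⊠ G) (ProdRoot G R) x ⇔ UnionRes G R k x
  InRes⇔UnionRes x = mk⇔
    (λ inRes → let i , dᵢ≡D , inResᵢ = Equivalence.to (⊠-InRes⇔ dist hd x) inRes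
               in i , Equivalence.from (isMax i) dᵢ≡D , inResᵢ)
    (λ (i , i<k , inResᵢ) → Equivalence.from (⊠-InRes⇔ dist hd x) (i , Equivalence.to (isMax i) i<k , inResᵢ))
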